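{- Let $r\ge 4$, let $H$ be an $r$-uniform hypergraph, and let $G$ be the simple graph obtained from $H$ by replacing each hyperedge by a complete graph $K_r$ on its vertex set (merging multiple edges). If $G$ contains a copy of $K_r$ on a set of $r$ vertices which is not a hyperedge of $H$, then $H$ contains an avoidable configuration (as a sub-hypergraph).
   Context: For an $r$-uniform hypergraph $C$ with $|C|$ vertices, $e(C)$ hyperedges and $c(C)$ components, its nullity is $n(C)=(r-1)e(C)+c(C)-|C|$. A connected hypergraph is complex if its nullity is at least $2$. An avoidable configuration is a connected, complex $r$-uniform hypergraph with at most $2\binom r2$ hyperedges. -}

module Defs where

open import Data.Nat using (ℕ; _∸_; _*_)
open import Data.Fin using (Fin)
open import Data.Fin.Subset using (Subset; _∈_; _∩_; ⋃; ∣_∣; Nonempty)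
open import Data.Fin.Subset.Properties using (_∈?_)
open import Data.List using (List; map; filter; allFin)
open import Data.Integer using (ℤ; +_; _-_; _+_)
open import Data.Product using (_×_)
open import Relation.Binary.Construct.Closure.ReflexiveTransitive using (Star)

-- An r-uniform hypergraph on vertex set Fin n with m hyperedges is given by
-- E : Fin m → Subset n (uniformity and simplicity are imposed in the statement).
-- A sub-hypergraph C is determined by a set S of hyperedge indices; its vertex
-- set is the union of its hyperedges.

module _ {n m : ℕ} (E : Fin m → Subset n) where

  vertexSet : Subset m → Subset n
  vertexSet S = ⋃ (map E (filter (_∈? S) (allFin m)))

  Adjacent : Subset m → Fin m → Fin m → Set
  Adjacent S i j = i ∈ S × j ∈ S × Nonempty (E i ∩ E j)

  Connected : Subset m → Set
  Connected S = Nonempty S × (∀ i j → i ∈ S → j ∈ S → Star (Adjacent S) i j)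

  -- nullity n(C) = (r-1) e(C) + c(C) - |C|, for connected C (so c(C) = 1)
  nullityConn : ℕ → Subset m → ℤ
  nullityConn r S = (+ ((r ∸ 1) * ∣ S ∣) + + 1) - + ∣ vertexSet S ∣

-- Grow a connected set S of hyperedges one edge at a time: adding an edge k ∉ S that meets
-- V(S) in s ≥ 1 vertices keeps S connected and raises the nullity (r - 1)|S| + 1 - |V(S)|
-- by at least s - 1. If some edge e meets K in three vertices u, v, w, pick x ∈ K outside e
-- (possible since e ≠ K and |e| = |K|) and add to e the edges covering xu, xv, xw: whichever
-- of them coincide, nullity 2 is reached with at most four edges. Otherwise no edge contains
-- three vertices of K, so for four vertices a, b, c, d of K (here r ≥ 4 is used) the edges
-- covering ab, ac, bc, ad, bd are distinct, and adding them in this order gains 0, 1, 0, 1.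
-- Five edges are within the bound 2 (r choose 2).

module Submission where

open import Data.Nat using (ℕ; zero; suc; _+_; _*_; _≤_; _<_; _<?_; s≤s; s≤s⁻¹; z≤n)
open import Data.Nat.Properties hiding (suc-injective; _≟_)
open import Data.Nat.Combinatorics using (_C_; nC1≡n; nCk+nC[k+1]≡[n+1]C[k+1])
open import Data.Nat.Tactic.RingSolver using (solve-∀)
open import Data.Fin using (Fin; zero; suc; _≟_)
open import Data.Fin.Patterns using (0F; 1F; 2F; 3F)
open import Data.Fin.Properties using (any?; suc-injective)
open import Data.Fin.Subset
open import Data.Fin.Subset.Properties
open import Data.Integer as ℤ using (+≤+)
open import Data.Integer.Properties using (m-n≡m⊖n; ⊖-≥)
open import Data.List using (List; []; _∷_; map; filter; allFin)
import Data.List.Membership.Propositional as List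
open import Data.List.Membership.Propositional.Properties using (∈-map⁺; ∈-map⁻; ∈-filter⁺; ∈-filter⁻; ∈-allFin)
open import Data.List.Relation.Unary.Any using (here; there)
open import Data.Vec using (_∷_; []; here; there)
open import Data.Product using (Σ; ∃; _×_; _,_; -,_; proj₁; proj₂)
open import Data.Sum using (inj₁; inj₂)
open import Function using (_∘_; _∘′_)
open import Function.Definitions using (Injective)
open import Relation.Binary.PropositionalEquality
open import Relation.Binary.Construct.Closure.ReflexiveTransitive as Star using (Star; ε; _◅_; _◅◅_)
open import Relation.Nullary using (¬_; yes; no; ¬?; contradiction; _×-dec_)
open import Relation.Nullary.Decidable using (decidable-stable; False; toWitnessFalse)
open import Defs

private variable
  n m : ℕ
  p q r : Subset n
  x y z : Fin n

∣p∪q∣+∣p∩q∣≡∣p∣+∣q∣ : ∀ (p q : Subset n) → ∣ p ∪ q ∣ + ∣ p ∩ q ∣ ≡ ∣ p ∣ + ∣ q ∣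
∣p∪q∣+∣p∩q∣≡∣p∣+∣q∣ []            []            = refl
∣p∪q∣+∣p∩q∣≡∣p∣+∣q∣ (inside  ∷ p) (inside  ∷ q) =
  cong suc (trans (+-suc _ _) (trans (cong suc (∣p∪q∣+∣p∩q∣≡∣p∣+∣q∣ p q)) (sym (+-suc _ _))))
∣p∪q∣+∣p∩q∣≡∣p∣+∣q∣ (inside  ∷ p) (outside ∷ q) = cong suc (∣p∪q∣+∣p∩q∣≡∣p∣+∣q∣ p q)
∣p∪q∣+∣p∩q∣≡∣p∣+∣q∣ (outside ∷ p) (inside  ∷ q) =
  trans (cong suc (∣p∪q∣+∣p∩q∣≡∣p∣+∣q∣ p q)) (sym (+-suc _ _))
∣p∪q∣+∣p∩q∣≡∣p∣+∣q∣ (outside ∷ p) (outside ∷ q) = ∣p∪q∣+∣p∩q∣≡∣p∣+∣q∣ p q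

∣p∪q∣≤∣p∣+∣q∣ : ∀ (p q : Subset n) → ∣ p ∪ q ∣ ≤ ∣ p ∣ + ∣ q ∣
∣p∪q∣≤∣p∣+∣q∣ p q = ≤-trans (m≤m+n _ _) (≤-reflexive (∣p∪q∣+∣p∩q∣≡∣p∣+∣q∣ p q))

x∈p⇒⁅x⁆⊆p : x ∈ p → ⁅ x ⁆ ⊆ p
x∈p⇒⁅x⁆⊆p {x = x} x∈p y∈⁅x⁆ = subst (_∈ _) (sym (x∈⁅y⁆⇒x≡y x y∈⁅x⁆)) x∈p

∪-least : p ⊆ r → q ⊆ r → p ∪ q ⊆ r
∪-least {p = p} {q = q} p⊆r q⊆r x∈p∪q with x∈p∪q⁻ p q x∈p∪q
... | inj₁ x∈p = p⊆r x∈p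
... | inj₂ x∈q = q⊆r x∈q

x∉p⇒∣p∪⁅x⁆∣≡1+∣p∣ : x ∉ p → ∣ p ∪ ⁅ x ⁆ ∣ ≡ suc ∣ p ∣
x∉p⇒∣p∪⁅x⁆∣≡1+∣p∣ {x = x} {p = p} x∉p = ≤-antisym
  (≤-trans (∣p∪q∣≤∣p∣+∣q∣ p ⁅ x ⁆)
           (≤-reflexive (trans (cong (_+_ ∣ p ∣) (∣⁅x⁆∣≡1 x)) (+-comm ∣ p ∣ 1))))
  (p⊂q⇒∣p∣<∣q∣ (p⊆p∪q ⁅ x ⁆ , x , x∈p∪q⁺ (inj₂ (x∈⁅x⁆ x)) , x∉p))

x∈p⇒0<∣p∣ : x ∈ p → 0 < ∣ p ∣
x∈p⇒0<∣p∣ {x = x} x∈p = subst (_≤ _) (∣⁅x⁆∣≡1 x) (p⊆q⇒∣p∣≤∣q∣ (x∈p⇒⁅x⁆⊆p x∈p))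

x,y∈p⇒1<∣p∣ : x ∈ p → y ∈ p → x ≢ y → 1 < ∣ p ∣
x,y∈p⇒1<∣p∣ {x = x} x∈p y∈p x≢y = subst (_< _) (∣⁅x⁆∣≡1 x)
  (p⊂q⇒∣p∣<∣q∣ (x∈p⇒⁅x⁆⊆p x∈p , _ , y∈p , x≢y ∘′ sym ∘′ x∈⁅y⁆⇒x≡y x))

x,y,z∈p⇒2<∣p∣ : x ∈ p → y ∈ p → z ∈ p → x ≢ y → x ≢ z → y ≢ z → 2 < ∣ p ∣
x,y,z∈p⇒2<∣p∣ {x = x} {y = y} {z = z} x∈p y∈p z∈p x≢y x≢z y≢z =
  ≤-trans (s≤s (x,y∈p⇒1<∣p∣ (x∈p∪q⁺ (inj₁ (x∈⁅x⁆ x))) (x∈p∪q⁺ (inj₂ (x∈⁅x⁆ y))) x≢y))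
          (p⊂q⇒∣p∣<∣q∣ (∪-least (x∈p⇒⁅x⁆⊆p x∈p) (x∈p⇒⁅x⁆⊆p y∈p) , z , z∈p , z∉⁅x⁆∪⁅y⁆))
  where
  z∉⁅x⁆∪⁅y⁆ : z ∉ ⁅ x ⁆ ∪ ⁅ y ⁆
  z∉⁅x⁆∪⁅y⁆ z∈ with x∈p∪q⁻ ⁅ x ⁆ ⁅ y ⁆ z∈
  ... | inj₁ z∈⁅x⁆ = x≢z (sym (x∈⁅y⁆⇒x≡y x z∈⁅x⁆))
  ... | inj₂ z∈⁅y⁆ = y≢z (sym (x∈⁅y⁆⇒x≡y y z∈⁅y⁆))

0<∣p∣⇒Nonempty : ∀ {n} {p : Subset n} → 0 < ∣ p ∣ → Nonempty p
0<∣p∣⇒Nonempty {n} {p} 0<∣p∣ with nonempty? p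
... | yes ne = ne
... | no ¬ne = contradiction (trans (cong ∣_∣ (Empty-unique ¬ne)) (∣⊥∣≡0 n)) (>⇒≢ 0<∣p∣)

p⊆q∧∣q∣≤∣p∣⇒p≡q : p ⊆ q → ∣ q ∣ ≤ ∣ p ∣ → p ≡ q
p⊆q∧∣q∣≤∣p∣⇒p≡q {p = p} p⊆q ∣q∣≤∣p∣ = ⊆-antisym p⊆q λ {x} x∈q →
  decidable-stable (x ∈? p) λ x∉p → <⇒≱ (p⊂q⇒∣p∣<∣q∣ (p⊆q , x , x∈q , x∉p)) ∣q∣≤∣p∣

∣p∣≤∣q∣∧p≢q⇒∃∈q∖p : ∣ p ∣ ≤ ∣ q ∣ → p ≢ q → ∃ λ x → x ∈ q × x ∉ p
∣p∣≤∣q∣∧p≢q⇒∃∈q∖p {p = p} {q = q} ∣p∣≤∣q∣ p≢q with any? (λ x → x ∈? q ×-dec ¬? (x ∈? p))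
... | yes found = found
... | no ¬found = contradiction (sym (p⊆q∧∣q∣≤∣p∣⇒p≡q q⊆p ∣p∣≤∣q∣)) p≢q
  where
  q⊆p : q ⊆ p
  q⊆p {x} x∈q = decidable-stable (x ∈? p) λ x∉p → ¬found (x , x∈q , x∉p)

k≤∣p∣⇒injection : ∀ {k} (p : Subset n) → k ≤ ∣ p ∣ →
  Σ (Fin k → Fin n) λ f → Injective _≡_ _≡_ f × (∀ i → f i ∈ p)
k≤∣p∣⇒injection {k = zero}  p            _           = (λ ()) , (λ { {()} }) , λ ()
k≤∣p∣⇒injection {k = suc k} (inside ∷ p) (s≤s k≤∣p∣) with k≤∣p∣⇒injection p k≤∣p∣
... | f , f-inj , f∈p = g , g-inj , g∈
  where
  g : Fin (suc k) → Fin _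
  g zero    = zero
  g (suc i) = suc (f i)
  g-inj : Injective _≡_ _≡_ g
  g-inj {zero}  {zero}  _  = refl
  g-inj {suc i} {suc j} eq = cong suc (f-inj (suc-injective eq))
  g∈ : ∀ i → g i ∈ inside ∷ p
  g∈ zero    = here
  g∈ (suc i) = there (f∈p i)
k≤∣p∣⇒injection (outside ∷ p) k≤∣p∣ with k≤∣p∣⇒injection p k≤∣p∣
... | f , f-inj , f∈p = suc ∘ f , f-inj ∘ suc-injective , there ∘ f∈p

x∈p∧y∉p⇒x≢y : x ∈ p → y ∉ p → x ≢ y
x∈p∧y∉p⇒x≢y x∈p y∉p refl = y∉p x∈p

x∉p∧x≢y⇒x∉p∪⁅y⁆ : x ∉ p → x ≢ y → x ∉ p ∪ ⁅ y ⁆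
x∉p∧x≢y⇒x∉p∪⁅y⁆ {p = p} {y = y} x∉p x≢y x∈ with x∈p∪q⁻ p ⁅ y ⁆ x∈
... | inj₁ x∈p    = x∉p x∈p
... | inj₂ x∈⁅y⁆ = x≢y (x∈⁅y⁆⇒x≡y y x∈⁅y⁆)

x∈⋃⁺ : ∀ {q} (qs : List (Subset n)) → q List.∈ qs → x ∈ q → x ∈ ⋃ qs
x∈⋃⁺ (q ∷ qs) (here refl) x∈q  = x∈p∪q⁺ (inj₁ x∈q)
x∈⋃⁺ (q ∷ qs) (there q∈qs) x∈q = x∈p∪q⁺ (inj₂ (x∈⋃⁺ qs q∈qs x∈q))

x∈⋃⁻ : ∀ (qs : List (Subset n)) → x ∈ ⋃ qs → ∃ λ q → q List.∈ qs × x ∈ q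
x∈⋃⁻ []       x∈⊥ = contradiction x∈⊥ ∉⊥
x∈⋃⁻ (q ∷ qs) x∈⋃ with x∈p∪q⁻ q (⋃ qs) x∈⋃
... | inj₁ x∈q  = q , here refl , x∈q
... | inj₂ x∈qs with x∈⋃⁻ qs x∈qs
...   | q′ , q′∈qs , x∈q′ = q′ , there q′∈qs , x∈q′

module Hypergraph (E : Fin m → Subset n) where

  private variable
    S : Subset m
    i j k k′ k″ : Fin m
    g c t : ℕ
    u v w : Fin n

  x∈vertexSet⁺ : i ∈ S → x ∈ E i → x ∈ vertexSet E S
  x∈vertexSet⁺ {i = i} {S = S} i∈S =
    x∈⋃⁺ _ (∈-map⁺ E (∈-filter⁺ (_∈? S) (∈-allFin i) i∈S))

  x∈vertexSet⁻ : x ∈ vertexSet E S → ∃ λ i → i ∈ S × x ∈ E i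
  x∈vertexSet⁻ {S = S} x∈V with x∈⋃⁻ (map E (filter (_∈? S) (allFin _))) x∈V
  ... | q , q∈ , x∈q with ∈-map⁻ E q∈
  ...   | i , i∈ , refl = i , proj₂ (∈-filter⁻ (_∈? S) {xs = allFin _} i∈) , x∈q

  vertexSet-⁅⁆ : vertexSet E ⁅ i ⁆ ⊆ E i
  vertexSet-⁅⁆ {i = i} x∈V with x∈vertexSet⁻ x∈V
  ... | j , j∈⁅i⁆ , x∈Ej = subst (λ j → _ ∈ E j) (x∈⁅y⁆⇒x≡y i j∈⁅i⁆) x∈Ej

  vertexSet-∪⁅⁆ : vertexSet E (S ∪ ⁅ k ⁆) ⊆ vertexSet E S ∪ E k
  vertexSet-∪⁅⁆ {S = S} {k = k} x∈V with x∈vertexSet⁻ x∈V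
  ... | j , j∈ , x∈Ej with x∈p∪q⁻ S ⁅ k ⁆ j∈
  ...   | inj₁ j∈S  = x∈p∪q⁺ (inj₁ (x∈vertexSet⁺ j∈S x∈Ej))
  ...   | inj₂ j∈⁅k⁆ = x∈p∪q⁺ (inj₂ (subst (λ j → _ ∈ E j) (x∈⁅y⁆⇒x≡y k j∈⁅k⁆) x∈Ej))

  connected-⁅⁆ : ∀ i → Connected E ⁅ i ⁆
  connected-⁅⁆ i = (i , x∈⁅x⁆ i) , walk
    where
    walk : ∀ j j′ → j ∈ ⁅ i ⁆ → j′ ∈ ⁅ i ⁆ → Star (Adjacent E ⁅ i ⁆) j j′
    walk j j′ j∈ j′∈ rewrite x∈⁅y⁆⇒x≡y i j∈ | x∈⁅y⁆⇒x≡y i j′∈ = ε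

  connected-∪⁅⁆ : Connected E S → Nonempty (vertexSet E S ∩ E k) → Connected E (S ∪ ⁅ k ⁆)
  connected-∪⁅⁆ {S = S} {k = k} (_ , walk) (x , x∈V∩Ek) with x∈p∩q⁻ (vertexSet E S) (E k) x∈V∩Ek
  ... | x∈V , x∈Ek with x∈vertexSet⁻ x∈V
  ... | i , i∈S , x∈Ei = (k , k∈) , walk′
    where
    S′ = S ∪ ⁅ k ⁆
    k∈ : k ∈ S′
    k∈ = x∈p∪q⁺ (inj₂ (x∈⁅x⁆ k))
    i∈ : i ∈ S′
    i∈ = x∈p∪q⁺ (inj₁ i∈S)
    lift : ∀ {j j′} → Star (Adjacent E S) j j′ → Star (Adjacent E S′) j j′
    lift = Star.map λ (j∈ , j′∈ , meet) → x∈p∪q⁺ (inj₁ j∈) , x∈p∪q⁺ (inj₁ j′∈) , meet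
    i–k : Star (Adjacent E S′) i k
    i–k = (i∈ , k∈ , x , x∈p∩q⁺ (x∈Ei , x∈Ek)) ◅ ε
    k–i : Star (Adjacent E S′) k i
    k–i = (k∈ , i∈ , x , x∈p∩q⁺ (x∈Ek , x∈Ei)) ◅ ε
    walk′ : ∀ j j′ → j ∈ S′ → j′ ∈ S′ → Star (Adjacent E S′) j j′
    walk′ j j′ j∈ j′∈ with x∈p∪q⁻ S ⁅ k ⁆ j∈ | x∈p∪q⁻ S ⁅ k ⁆ j′∈
    ... | inj₁ j∈S  | inj₁ j′∈S = lift (walk j j′ j∈S j′∈S)
    ... | inj₁ j∈S  | inj₂ j′∈k rewrite x∈⁅y⁆⇒x≡y k j′∈k = lift (walk j i j∈S i∈S) ◅◅ i–k
    ... | inj₂ j∈k  | inj₁ j′∈S rewrite x∈⁅y⁆⇒x≡y k j∈k = k–i ◅◅ lift (walk i j′ i∈S j′∈S)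
    ... | inj₂ j∈k  | inj₂ j′∈k rewrite x∈⁅y⁆⇒x≡y k j∈k | x∈⁅y⁆⇒x≡y k j′∈k = ε

  x∈vertexSet-⁅⁆ : x ∈ E k → x ∈ vertexSet E ⁅ k ⁆
  x∈vertexSet-⁅⁆ {k = k} = x∈vertexSet⁺ (x∈⁅x⁆ k)

  x∈vertexSet-∪⁅⁆ˡ : x ∈ vertexSet E S → x ∈ vertexSet E (S ∪ ⁅ k ⁆)
  x∈vertexSet-∪⁅⁆ˡ x∈V with x∈vertexSet⁻ x∈V
  ... | i , i∈S , x∈Ei = x∈vertexSet⁺ (x∈p∪q⁺ (inj₁ i∈S)) x∈Ei

  x∈vertexSet-∪⁅⁆ʳ : x ∈ E k → x ∈ vertexSet E (S ∪ ⁅ k ⁆)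
  x∈vertexSet-∪⁅⁆ʳ {k = k} = x∈vertexSet⁺ (x∈p∪q⁺ (inj₂ (x∈⁅x⁆ k)))

  x∈Ei∧x∉Ej⇒i≢j : x ∈ E i → x ∉ E j → i ≢ j
  x∈Ei∧x∉Ej⇒i≢j x∈Ei x∉Ej refl = x∉Ej x∈Ei

  Shared : Subset m → Fin m → Fin n → Set
  Shared S k x = x ∈ vertexSet E S × x ∈ E k

  module Uniform (d : ℕ) (∣E∣ : ∀ i → ∣ E i ∣ ≡ suc d) where

    -- With r = suc d, nullity≥ says (r - 1)∣S∣ + 1 - ∣V(S)∣ ≥ g without subtraction.
    record Cluster (S : Subset m) (g c : ℕ) : Set where
      field
        connected : Connected E S
        nullity≥  : ∣ vertexSet E S ∣ + g ≤ d * ∣ S ∣ + 1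
        size≤     : ∣ S ∣ ≤ c

    cluster-⁅⁆ : ∀ e → Cluster ⁅ e ⁆ 0 1
    cluster-⁅⁆ e = record
      { connected = connected-⁅⁆ e
      ; nullity≥  = begin
          ∣ vertexSet E ⁅ e ⁆ ∣ + 0 ≡⟨ +-identityʳ _ ⟩
          ∣ vertexSet E ⁅ e ⁆ ∣     ≤⟨ p⊆q⇒∣p∣≤∣q∣ (vertexSet-⁅⁆) ⟩
          ∣ E e ∣                   ≡⟨ ∣E∣ e ⟩
          suc d                     ≡⟨ +-comm 1 d ⟩
          d + 1                     ≡⟨ cong (_+ 1) (*-identityʳ d) ⟨
          d * 1 + 1                 ≡⟨ cong (λ s → d * s + 1) (∣⁅x⁆∣≡1 e) ⟨
          d * ∣ ⁅ e ⁆ ∣ + 1         ∎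
      ; size≤     = ≤-reflexive (∣⁅x⁆∣≡1 e)
      }
      where open ≤-Reasoning

    extend : Cluster S g c → k ∉ S → suc t ≤ ∣ vertexSet E S ∩ E k ∣ →
             Cluster (S ∪ ⁅ k ⁆) (t + g) (suc c)
    extend {S = S} {g = g} {c = c} {k = k} {t = t} cl k∉S t<∣W∩Ek∣ = record
      { connected = connected-∪⁅⁆ connected (0<∣p∣⇒Nonempty (≤-trans (s≤s z≤n) t<∣W∩Ek∣))
      ; nullity≥  = subst (λ s → ∣ vertexSet E (S ∪ ⁅ k ⁆) ∣ + (t + g) ≤ d * s + 1)
                          (sym ∣S∪⁅k⁆∣) counting
      ; size≤     = subst (_≤ suc c) (sym ∣S∪⁅k⁆∣) (s≤s size≤)
      }
      where
      open Cluster cl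
      W = vertexSet E S
      ∣S∪⁅k⁆∣ : ∣ S ∪ ⁅ k ⁆ ∣ ≡ suc ∣ S ∣
      ∣S∪⁅k⁆∣ = x∉p⇒∣p∪⁅x⁆∣≡1+∣p∣ k∉S
      counting : ∣ vertexSet E (S ∪ ⁅ k ⁆) ∣ + (t + g) ≤ d * suc ∣ S ∣ + 1
      counting = s≤s⁻¹ (begin
        suc (∣ vertexSet E (S ∪ ⁅ k ⁆) ∣ + (t + g)) ≡⟨ +-suc _ (t + g) ⟨
        ∣ vertexSet E (S ∪ ⁅ k ⁆) ∣ + (suc t + g)   ≤⟨ +-mono-≤ (p⊆q⇒∣p∣≤∣q∣ vertexSet-∪⁅⁆)
                                                                 (+-monoˡ-≤ g t<∣W∩Ek∣) ⟩
        ∣ W ∪ E k ∣ + (∣ W ∩ E k ∣ + g)            ≡⟨ +-assoc ∣ W ∪ E k ∣ _ g ⟨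
        ∣ W ∪ E k ∣ + ∣ W ∩ E k ∣ + g              ≡⟨ cong (_+ g) (∣p∪q∣+∣p∩q∣≡∣p∣+∣q∣ W (E k)) ⟩
        ∣ W ∣ + ∣ E k ∣ + g                        ≡⟨ cong (λ e → ∣ W ∣ + e + g) (∣E∣ k) ⟩
        ∣ W ∣ + suc d + g                          ≡⟨ reorder ∣ W ∣ d g ⟩
        suc d + (∣ W ∣ + g)                        ≤⟨ +-monoʳ-≤ (suc d) nullity≥ ⟩
        suc d + (d * ∣ S ∣ + 1)                    ≡⟨ distribute d ∣ S ∣ ⟩
        suc (d * suc ∣ S ∣ + 1)                    ∎)
        where
        open ≤-Reasoning
        reorder : ∀ w d g → w + suc d + g ≡ suc d + (w + g)
        reorder = solve-∀
        distribute : ∀ d s → suc d + (d * s + 1) ≡ suc (d * suc s + 1)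
        distribute = solve-∀

    extend₁ : Cluster S g c → k ∉ S → Shared S k x → Cluster (S ∪ ⁅ k ⁆) g (suc c)
    extend₁ cl k∉S x∈ = extend cl k∉S (x∈p⇒0<∣p∣ (x∈p∩q⁺ x∈))

    extend₂ : Cluster S g c → k ∉ S → Shared S k x → Shared S k y → x ≢ y →
              Cluster (S ∪ ⁅ k ⁆) (suc g) (suc c)
    extend₂ cl k∉S x∈ y∈ x≢y = extend cl k∉S (x,y∈p⇒1<∣p∣ (x∈p∩q⁺ x∈) (x∈p∩q⁺ y∈) x≢y)

    extend₃ : Cluster S g c → k ∉ S → Shared S k x → Shared S k y → Shared S k z →
              x ≢ y → x ≢ z → y ≢ z → Cluster (S ∪ ⁅ k ⁆) (suc (suc g)) (suc c)
    extend₃ cl k∉S x∈ y∈ z∈ x≢y x≢z y≢z =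
      extend cl k∉S (x,y,z∈p⇒2<∣p∣ (x∈p∩q⁺ x∈) (x∈p∩q⁺ y∈) (x∈p∩q⁺ z∈) x≢y x≢z y≢z)

    SmallComplex : Set
    SmallComplex = Σ (Subset m) λ S → ∃ λ c → Cluster S 2 c × c ≤ 5

    module Fan {e : Fin m} {x : Fin n} (x∉Ee : x ∉ E e) where

      x∈Ek⇒k∉⁅e⁆ : x ∈ E k → k ∉ ⁅ e ⁆
      x∈Ek⇒k∉⁅e⁆ x∈Ek = x≢y⇒x∉⁅y⁆ (x∈Ei∧x∉Ej⇒i≢j x∈Ek x∉Ee)

      one-edge-through-x : u ∈ E e → v ∈ E e → w ∈ E e → u ≢ v → u ≢ w → v ≢ w →
                           x ∈ E k → u ∈ E k → v ∈ E k → w ∈ E k → Cluster (⁅ e ⁆ ∪ ⁅ k ⁆) 2 2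
      one-edge-through-x u∈e v∈e w∈e u≢v u≢w v≢w x∈k u∈k v∈k w∈k =
        extend₃ (cluster-⁅⁆ e) (x∈Ek⇒k∉⁅e⁆ x∈k)
          (x∈vertexSet-⁅⁆ u∈e , u∈k) (x∈vertexSet-⁅⁆ v∈e , v∈k) (x∈vertexSet-⁅⁆ w∈e , w∈k) u≢v u≢w v≢w

      two-edges-through-x : u ∈ E e → v ∈ E e → w ∈ E e → u ≢ v →
                            x ∈ E k → u ∈ E k → v ∈ E k → x ∈ E k′ → w ∈ E k′ → k′ ≢ k →
                            Cluster ((⁅ e ⁆ ∪ ⁅ k ⁆) ∪ ⁅ k′ ⁆) 2 3
      two-edges-through-x {k = k} u∈e v∈e w∈e u≢v x∈k u∈k v∈k x∈k′ w∈k′ k′≢k =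
        extend₂ C₁ (x∉p∧x≢y⇒x∉p∪⁅y⁆ (x∈Ek⇒k∉⁅e⁆ x∈k′) k′≢k)
          (x∈vertexSet-∪⁅⁆ˡ (x∈vertexSet-⁅⁆ w∈e) , w∈k′) (x∈vertexSet-∪⁅⁆ʳ x∈k , x∈k′)
          (x∈p∧y∉p⇒x≢y w∈e x∉Ee)
        where
        C₁ : Cluster (⁅ e ⁆ ∪ ⁅ k ⁆) 1 2
        C₁ = extend₂ (cluster-⁅⁆ e) (x∈Ek⇒k∉⁅e⁆ x∈k)
               (x∈vertexSet-⁅⁆ u∈e , u∈k) (x∈vertexSet-⁅⁆ v∈e , v∈k) u≢v

      three-edges-through-x : u ∈ E e → v ∈ E e → w ∈ E e →
                              x ∈ E k → u ∈ E k → x ∈ E k′ → v ∈ E k′ → x ∈ E k″ → w ∈ E k″ →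
                              k′ ≢ k → k″ ≢ k → k″ ≢ k′ →
                              Cluster (((⁅ e ⁆ ∪ ⁅ k ⁆) ∪ ⁅ k′ ⁆) ∪ ⁅ k″ ⁆) 2 4
      three-edges-through-x {k = k} {k′ = k′} u∈e v∈e w∈e x∈k u∈k x∈k′ v∈k′ x∈k″ w∈k″ k′≢k k″≢k k″≢k′ =
        extend₂ C₂ (x∉p∧x≢y⇒x∉p∪⁅y⁆ (x∉p∧x≢y⇒x∉p∪⁅y⁆ (x∈Ek⇒k∉⁅e⁆ x∈k″) k″≢k) k″≢k′)
          (x∈vertexSet-∪⁅⁆ˡ (x∈vertexSet-∪⁅⁆ˡ (x∈vertexSet-⁅⁆ w∈e)) , w∈k″)
          (x∈vertexSet-∪⁅⁆ˡ (x∈vertexSet-∪⁅⁆ʳ x∈k) , x∈k″)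
          (x∈p∧y∉p⇒x≢y w∈e x∉Ee)
        where
        C₁ : Cluster (⁅ e ⁆ ∪ ⁅ k ⁆) 0 2
        C₁ = extend₁ (cluster-⁅⁆ e) (x∈Ek⇒k∉⁅e⁆ x∈k) (x∈vertexSet-⁅⁆ u∈e , u∈k)
        C₂ : Cluster ((⁅ e ⁆ ∪ ⁅ k ⁆) ∪ ⁅ k′ ⁆) 1 3
        C₂ = extend₂ C₁ (x∉p∧x≢y⇒x∉p∪⁅y⁆ (x∈Ek⇒k∉⁅e⁆ x∈k′) k′≢k)
               (x∈vertexSet-∪⁅⁆ˡ (x∈vertexSet-⁅⁆ v∈e) , v∈k′) (x∈vertexSet-∪⁅⁆ʳ x∈k , x∈k′)
               (x∈p∧y∉p⇒x≢y v∈e x∉Ee)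

      fan : {f : Fin 3 → Fin n} → Injective _≡_ _≡_ f → (∀ i → f i ∈ E e) →
            (∀ i → ∃ λ k → x ∈ E k × f i ∈ E k) → SmallComplex
      fan {f} f-inj f∈e through = by-coincidences (through 0F) (through 1F) (through 2F)
        where
        u∈e = f∈e 0F
        v∈e = f∈e 1F
        w∈e = f∈e 2F
        u≢v : f 0F ≢ f 1F
        u≢v = (λ ()) ∘ f-inj
        u≢w : f 0F ≢ f 2F
        u≢w = (λ ()) ∘ f-inj
        v≢w : f 1F ≢ f 2F
        v≢w = (λ ()) ∘ f-inj
        by-coincidences : (∃ λ k → x ∈ E k × f 0F ∈ E k) → (∃ λ k → x ∈ E k × f 1F ∈ E k) →
                          (∃ λ k → x ∈ E k × f 2F ∈ E k) → SmallComplex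
        by-coincidences (k , x∈k , u∈k) (k′ , x∈k′ , v∈k′) (k″ , x∈k″ , w∈k″)
          with k′ ≟ k | k″ ≟ k | k″ ≟ k′
        ... | yes refl | yes refl | _ =
          -, -, one-edge-through-x u∈e v∈e w∈e u≢v u≢w v≢w x∈k u∈k v∈k′ w∈k″ , m≤m+n 2 3
        ... | yes refl | no k″≢k | _ =
          -, -, two-edges-through-x u∈e v∈e w∈e u≢v x∈k u∈k v∈k′ x∈k″ w∈k″ k″≢k , m≤m+n 3 2
        ... | no k′≢k | yes refl | _ =
          -, -, two-edges-through-x u∈e w∈e v∈e u≢w x∈k u∈k w∈k″ x∈k′ v∈k′ k′≢k , m≤m+n 3 2
        ... | no k′≢k | no _ | yes refl =
          -, -, two-edges-through-x v∈e w∈e u∈e v≢w x∈k′ v∈k′ w∈k″ x∈k u∈k (k′≢k ∘ sym) , m≤m+n 3 2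
        ... | no k′≢k | no k″≢k | no k″≢k′ =
          -, -, three-edges-through-x u∈e v∈e w∈e x∈k u∈k x∈k′ v∈k′ x∈k″ w∈k″ k′≢k k″≢k k″≢k′ , m≤m+n 4 1

    module K₄ {K : Subset n} (sparse : ∀ k → ¬ 2 < ∣ E k ∩ K ∣)
              {f : Fin 4 → Fin n} (f-inj : Injective _≡_ _≡_ f) (f∈K : ∀ i → f i ∈ K)
              (pair : ∀ i j → i ≢ j → ∃ λ k → f i ∈ E k × f j ∈ E k) where

      -- The False arguments are computed away when i, j, l are distinct numerals.
      apart : ∀ i j l {i≢j : False (i ≟ j)} {i≢l : False (i ≟ l)} {j≢l : False (j ≟ l)} →
              f i ∈ E k → f j ∈ E k → f l ∈ E k′ → k ≢ k′
      apart {k = k} i j l {i≢j} {i≢l} {j≢l} fi∈k fj∈k fl∈k′ refl =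
        sparse k (x,y,z∈p⇒2<∣p∣ (x∈p∩q⁺ (fi∈k , f∈K i)) (x∈p∩q⁺ (fj∈k , f∈K j)) (x∈p∩q⁺ (fl∈k′ , f∈K l))
                                (f-≢ i≢j) (f-≢ i≢l) (f-≢ j≢l))
        where
        f-≢ : ∀ {i j} → False (i ≟ j) → f i ≢ f j
        f-≢ i≢j = toWitnessFalse i≢j ∘ f-inj

      small-complex : SmallComplex
      small-complex with pair 0F 1F (λ ()) | pair 0F 2F (λ ()) | pair 1F 2F (λ ())
                       | pair 0F 3F (λ ()) | pair 1F 3F (λ ())
      ... | kab , a∈kab , b∈kab | kac , a∈kac , c∈kac | kbc , b∈kbc , c∈kbc
          | kad , a∈kad , d∈kad | kbd , b∈kbd , d∈kbd = -, -, C₄ , ≤-refl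
        where
        C₁ : Cluster (⁅ kab ⁆ ∪ ⁅ kac ⁆) 0 2
        C₁ = extend₁ (cluster-⁅⁆ kab)
               (x≢y⇒x∉⁅y⁆ (apart 0F 2F 1F a∈kac c∈kac b∈kab))
               (x∈vertexSet-⁅⁆ a∈kab , a∈kac)
        C₂ : Cluster ((⁅ kab ⁆ ∪ ⁅ kac ⁆) ∪ ⁅ kbc ⁆) 1 3
        C₂ = extend₂ C₁
               (x∉p∧x≢y⇒x∉p∪⁅y⁆ (x≢y⇒x∉⁅y⁆ (apart 1F 2F 0F b∈kbc c∈kbc a∈kab))
                                 (apart 1F 2F 0F b∈kbc c∈kbc a∈kac))
               (x∈vertexSet-∪⁅⁆ˡ (x∈vertexSet-⁅⁆ b∈kab) , b∈kbc)
               (x∈vertexSet-∪⁅⁆ʳ c∈kac , c∈kbc)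
               ((λ ()) ∘ f-inj)
        C₃ : Cluster (((⁅ kab ⁆ ∪ ⁅ kac ⁆) ∪ ⁅ kbc ⁆) ∪ ⁅ kad ⁆) 1 4
        C₃ = extend₁ C₂
               (x∉p∧x≢y⇒x∉p∪⁅y⁆ (x∉p∧x≢y⇒x∉p∪⁅y⁆ (x≢y⇒x∉⁅y⁆ (apart 0F 3F 1F a∈kad d∈kad b∈kab))
                                                   (apart 0F 3F 2F a∈kad d∈kad c∈kac))
                                 (apart 0F 3F 1F a∈kad d∈kad b∈kbc))
               (x∈vertexSet-∪⁅⁆ˡ (x∈vertexSet-∪⁅⁆ˡ (x∈vertexSet-⁅⁆ a∈kab)) , a∈kad)
        C₄ : Cluster ((((⁅ kab ⁆ ∪ ⁅ kac ⁆) ∪ ⁅ kbc ⁆) ∪ ⁅ kad ⁆) ∪ ⁅ kbd ⁆) 2 5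
        C₄ = extend₂ C₃
               (x∉p∧x≢y⇒x∉p∪⁅y⁆ (x∉p∧x≢y⇒x∉p∪⁅y⁆ (x∉p∧x≢y⇒x∉p∪⁅y⁆ (x≢y⇒x∉⁅y⁆
                 (apart 1F 3F 0F b∈kbd d∈kbd a∈kab))
                 (apart 1F 3F 0F b∈kbd d∈kbd a∈kac))
                 (apart 1F 3F 2F b∈kbd d∈kbd c∈kbc))
                 (apart 1F 3F 0F b∈kbd d∈kbd a∈kad))
               (x∈vertexSet-∪⁅⁆ˡ (x∈vertexSet-∪⁅⁆ˡ (x∈vertexSet-∪⁅⁆ˡ (x∈vertexSet-⁅⁆ b∈kab))) , b∈kbd)
               (x∈vertexSet-∪⁅⁆ʳ d∈kad , d∈kbd)
               ((λ ()) ∘ f-inj)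

    module _ {K : Subset n} (∣K∣ : ∣ K ∣ ≡ suc d)
             (covered : ∀ u v → u ∈ K → v ∈ K → u ≢ v → ∃ λ k → u ∈ E k × v ∈ E k) where

      rich⇒small-complex : ∀ {e} → E e ≢ K → 2 < ∣ E e ∩ K ∣ → SmallComplex
      rich⇒small-complex {e} Ee≢K rich
        with k≤∣p∣⇒injection (E e ∩ K) rich
           | ∣p∣≤∣q∣∧p≢q⇒∃∈q∖p (≤-reflexive (trans (∣E∣ e) (sym ∣K∣))) Ee≢K
      ... | f , f-inj , f∈Ee∩K | x , x∈K , x∉Ee = Fan.fan x∉Ee f-inj f∈Ee through
        where
        f∈Ee : ∀ i → f i ∈ E e
        f∈Ee i = proj₁ (x∈p∩q⁻ (E e) K (f∈Ee∩K i))
        through : ∀ i → ∃ λ k → x ∈ E k × f i ∈ E k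
        through i = covered x (f i) x∈K (proj₂ (x∈p∩q⁻ (E e) K (f∈Ee∩K i)))
                      (x∈p∧y∉p⇒x≢y (f∈Ee i) x∉Ee ∘ sym)

      sparse⇒small-complex : 4 ≤ suc d → (∀ k → ¬ 2 < ∣ E k ∩ K ∣) → SmallComplex
      sparse⇒small-complex 4≤r sparse with k≤∣p∣⇒injection K (subst (4 ≤_) (sym ∣K∣) 4≤r)
      ... | f , f-inj , f∈K = K₄.small-complex sparse f-inj f∈K
                                (λ i j i≢j → covered (f i) (f j) (f∈K i) (f∈K j) (i≢j ∘ f-inj))

      small-complex : 4 ≤ suc d → (∀ i → E i ≢ K) → SmallComplex
      small-complex 4≤r E≢K with any? (λ e → 2 <? ∣ E e ∩ K ∣)
      ... | yes (e , rich) = rich⇒small-complex (E≢K e) rich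
      ... | no ¬rich       = sparse⇒small-complex 4≤r (λ k → ¬rich ∘ (k ,_))

-- Opened only now: in scope earlier, ℤ's prefix +_ would make the ℕ sums ambiguous.
open import Data.Integer using (+_)

n≤[1+n]C2 : ∀ n → n ≤ suc n C 2
n≤[1+n]C2 n = subst (n ≤_) (nCk+nC[k+1]≡[n+1]C[k+1] n 1)
                (subst (_≤ n C 1 + n C 2) (nC1≡n n) (m≤m+n (n C 1) (n C 2)))

5≤2*rC2 : ∀ {r} → 4 ≤ r → 5 ≤ 2 * (r C 2)
5≤2*rC2 {suc d} (s≤s 3≤d) = ≤-trans (m≤m+n 5 1) (*-monoʳ-≤ 2 (≤-trans 3≤d (n≤[1+n]C2 d)))

n+k≤m⇒+k≤+m-+n : ∀ {k m n} → n + k ≤ m → + k ℤ.≤ + m ℤ.- + n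
n+k≤m⇒+k≤+m-+n {k} {m} {n} n+k≤m =
  subst (+ k ℤ.≤_) (sym (trans (m-n≡m⊖n m n) (⊖-≥ (m+n≤o⇒m≤o n n+k≤m))))
        (+≤+ (m+n≤o⇒m≤o∸n k (subst (_≤ m) (+-comm n k) n+k≤m)))

lemma2 : (r n m : ℕ) → 4 ≤ r → (E : Fin m → Subset n)
    → (∀ i → ∣ E i ∣ ≡ r)
    → Injective _≡_ _≡_ E
    → (K : Subset n) → ∣ K ∣ ≡ r
    → (∀ u v → u ∈ K → v ∈ K → u ≢ v → ∃ λ i → u ∈ E i × v ∈ E i)
    → (∀ i → E i ≢ K)
    → Σ (Subset m) λ S → Connected E S × (+ 2) ℤ.≤ nullityConn E r S × ∣ S ∣ ≤ 2 * (r C 2)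
lemma2 zero    _ _ () _ _ _ _ _ _ _
lemma2 (suc d) n m 4≤r E ∣E∣ _ K ∣K∣ covered E≢K
  with Hypergraph.Uniform.small-complex E d ∣E∣ ∣K∣ covered 4≤r E≢K
... | S , c , cluster , c≤5 =
  S , connected , n+k≤m⇒+k≤+m-+n nullity≥ , ≤-trans size≤ (≤-trans c≤5 (5≤2*rC2 4≤r))
  where open Hypergraph.Uniform.Cluster cluster
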